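{- Let $S\subseteq X$ be a non-empty generalised nice set and $J\subseteq I$ with $|J|=4$, and suppose $S'_J=S\cup\{\{0,0\}\}\cup\{\{0,j\}:j\in J\}$ is a generalised nice set. Then $|S|=1$ and $S'_J$ is collinear to one of the sets $\{\{0,0\},\{0,3\},\{0,4\},\{0,6\},\{0,7\},\{1,2\}\}$ or $\{\{0,0\},\{0,1\},\{0,2\},\{0,3\},\{0,5\},\{1,2\}\}$.
   Context: Let $I=\{1,\dots,7\}$ and $I_0=I\cup\{0\}$. The Fano plane on $I$ has the seven lines $\{1,2,5\},\{5,6,7\},\{1,4,7\},\{1,3,6\},\{2,4,6\},\{2,3,7\},\{3,4,5\}$. For distinct $i,j\in I$, $i*j$ is the third point of the unique line containing $i$ and $j$. The operation is extended to $I_0$ by $0*i=i*0=i$ and $i*i=0$ for all $i\in I_0$. A collineation is a bijection $\sigma:I_0\to I_0$ with $\sigma(i*j)=\sigma(i)*\sigma(j)$ for all $i,j\in I_0$. Let $X_0$ be the set of unordered pairs $\{i,j\}$ with $i,j\in I_0$, where $i=j$ is allowed, and $X=\{\{i,j\}:i,j\in I,\ i\neq j\}$. A collineation $\sigma$ acts on $X_0$ by $\tilde\sigma(\{i,j\})=\{\sigma(i),\sigma(j)\}$, hence on subsets; subsets $T,T'\subseteq X_0$ are collinear if $\tilde\sigma(T)=T'$ for some collineation $\sigma$. For $i,j,k\in I_0$ let $P_{\{i,j,k\}}=\{\{i,j\},\{j,k\},\{k,i\},\{i,j*k\},\{j,k*i\},\{k,i*j\}\}\subseteq X_0$. A subset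 $T\subseteq X_0$ is a generalised nice set if for all $i,j,k\in I_0$, $\{i,j\}\in T$ and $\{i*j,k\}\in T$ imply $P_{\{i,j,k\}}\subseteq T$. -}

module Defs where

open import Data.Nat using (ℕ; zero; suc; _+_; _≤ᵇ_)
open import Data.Bool using (Bool; true; false; _∧_; _∨_; if_then_else_)
open import Data.Fin using (Fin; toℕ; #_)
open import Data.Fin.Properties using (_≟_)
open import Data.Vec using (Vec; []; _∷_; lookup)
open import Data.List using (List; []; _∷_; allFin)
open import Data.Product using (Σ; _×_; _,_; ∃)
open import Relation.Nullary.Decidable using (⌊_⌋)
open import Relation.Binary.PropositionalEquality using (_≡_)
open import Function.Bundles using (_↔_; Inverse)

Pt : Set
Pt = Fin 8

-- Multiplication table of the Fano-plane operation * on I₀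
-- (row i, column j contains i * j).
table : Vec (Vec Pt 8) 8
table =
    (# 0 ∷ # 1 ∷ # 2 ∷ # 3 ∷ # 4 ∷ # 5 ∷ # 6 ∷ # 7 ∷ [])
  ∷ (# 1 ∷ # 0 ∷ # 5 ∷ # 6 ∷ # 7 ∷ # 2 ∷ # 3 ∷ # 4 ∷ [])
  ∷ (# 2 ∷ # 5 ∷ # 0 ∷ # 7 ∷ # 6 ∷ # 1 ∷ # 4 ∷ # 3 ∷ [])
  ∷ (# 3 ∷ # 6 ∷ # 7 ∷ # 0 ∷ # 5 ∷ # 4 ∷ # 1 ∷ # 2 ∷ [])
  ∷ (# 4 ∷ # 7 ∷ # 6 ∷ # 5 ∷ # 0 ∷ # 3 ∷ # 2 ∷ # 1 ∷ [])
  ∷ (# 5 ∷ # 2 ∷ # 1 ∷ # 4 ∷ # 3 ∷ # 0 ∷ # 7 ∷ # 6 ∷ [])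
  ∷ (# 6 ∷ # 3 ∷ # 4 ∷ # 1 ∷ # 2 ∷ # 7 ∷ # 0 ∷ # 5 ∷ [])
  ∷ (# 7 ∷ # 4 ∷ # 3 ∷ # 2 ∷ # 1 ∷ # 6 ∷ # 5 ∷ # 0 ∷ [])
  ∷ []

infixl 7 _*_
_*_ : Pt → Pt → Pt
i * j = lookup (lookup table i) j

-- A subset T of X₀ (unordered pairs {i,j}, i = j allowed) is represented by a
-- symmetric Boolean relation: {i,j} ∈ T  iff  T i j ≡ true.
PairSet : Set
PairSet = Pt → Pt → Bool

Symmetric : PairSet → Set
Symmetric T = ∀ i j → T i j ≡ T j i

_∈P_ : Pt × Pt → PairSet → Set
(i , j) ∈P T = T i j ≡ true

SubsetOfX : PairSet → Set
SubsetOfX T = (∀ i → T i i ≡ false) × (∀ j → T (# 0) j ≡ false)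

NonEmpty : PairSet → Set
NonEmpty T = Σ Pt λ i → Σ Pt λ j → (i , j) ∈P T

countList : List Bool → ℕ
countList [] = 0
countList (true ∷ bs) = suc (countList bs)
countList (false ∷ bs) = countList bs

card : PairSet → ℕ
card T = sumL (allFin 8)
  where
  row : Pt → List Pt → ℕ
  row i [] = 0
  row i (j ∷ js) = (if (toℕ i ≤ᵇ toℕ j) ∧ T i j then 1 else 0) + row i js
  sumL : List Pt → ℕ
  sumL [] = 0
  sumL (i ∷ is) = row i (allFin 8) + sumL is

PSub : Pt → Pt → Pt → PairSet → Set
PSub i j k T =
    ((i , j) ∈P T) × ((j , k) ∈P T) × ((k , i) ∈P T)
  × ((i , j * k) ∈P T) × ((j , k * i) ∈P T) × ((k , i * j) ∈P T)

GenNice : PairSet → Set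
GenNice T = ∀ i j k → (i , j) ∈P T → (i * j , k) ∈P T → PSub i j k T

record Collineation : Set where
  field
    σ : Pt ↔ Pt
    hom : ∀ i j → Inverse.to σ (i * j) ≡ Inverse.to σ i * Inverse.to σ j

-- T and T' are collinear: σ̃(T) = T' for some collineation σ, i.e.
-- {σ i, σ j} ∈ T'  iff  {i,j} ∈ T  (σ is a bijection).
Collinear : PairSet → PairSet → Set
Collinear T T' = Σ Collineation λ c →
  ∀ i j → T' (Inverse.to (Collineation.σ c) i) (Inverse.to (Collineation.σ c) j) ≡ T i j

infix 4 _==_
_==_ : Pt → Pt → Bool
i == j = ⌊ i ≟ j ⌋

fromPairs : List (Pt × Pt) → PairSet
fromPairs [] i j = false
fromPairs ((a , b) ∷ ps) i j =
  ((a == i) ∧ (b == j)) ∨ ((a == j) ∧ (b == i)) ∨ fromPairs ps i j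

S'J : PairSet → (Pt → Bool) → PairSet
S'J S J i j =
  S i j ∨ ((i == # 0) ∧ ((j == # 0) ∨ J j)) ∨ ((j == # 0) ∧ ((i == # 0) ∨ J i))

A₁ : PairSet
A₁ = fromPairs ((# 0 , # 0) ∷ (# 0 , # 3) ∷ (# 0 , # 4) ∷ (# 0 , # 6) ∷ (# 0 , # 7) ∷ (# 1 , # 2) ∷ [])

A₂ : PairSet
A₂ = fromPairs ((# 0 , # 0) ∷ (# 0 , # 1) ∷ (# 0 , # 2) ∷ (# 0 , # 3) ∷ (# 0 , # 5) ∷ (# 1 , # 2) ∷ [])

module Submission where

-- Niceness of S'_J forces every edge {c,d} of S to span a line {c, d, c*d} lying entirely inside
-- J or entirely outside it, and a 4-subset of the Fano plane has exactly one such line.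
-- Identifying I₀ with 𝔽₂³, the collineation sending 1, 2, 3 to c, d and a point of J off that
-- line pulls J back to {3,4,6,7} (J is the complement of the line) or to {1,2,3,5} (J is the
-- line plus a point).  In these coordinates every edge of the pulled-back S lies on the line
-- {1,2,5}, and niceness of S forbids {u,v} and {u*v,v} from both being edges, so {1,2} is the
-- only edge.  Hence S = {{c,d}}, and the inverse collineation maps S'_J onto A₁ or A₂.

open import Defs
open import Data.Bool using (Bool; true; false)
import Data.Bool.Properties as Bool
open import Data.Empty using (⊥; ⊥-elim)
open import Data.Fin using (#_)
open import Data.Fin.Patterns using (0F; 1F; 2F; 3F; 4F; 5F; 6F; 7F)
open import Data.Fin.Properties using (_≟_; all?; any?)
open import Data.Fin.Subset using (Subset; _∉_; ∣_∣; ⁅_⁆; _∪_; inside; outside)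
open import Data.Fin.Subset.Properties using (_∈?_)
open import Data.List using ([]; _∷_)
open import Data.Nat using (zero; suc)
import Data.Nat.Properties as ℕ
open import Data.Product using (_×_; _,_; ∃; proj₁; proj₂; map₂)
open import Data.Sum using (_⊎_; inj₁; inj₂)
open import Data.Vec using (Vec; []; _∷_; lookup)
open import Data.Vec.Properties using (tabulate-cong)
open import Function using (_∘_; mk⇔)
open import Function.Bundles using (Inverse; mk⤖)
open import Function.Consequences.Propositional using (strictlySurjective⇒surjective)
open import Function.Definitions using (Injective; StrictlySurjective)
open import Function.Properties.Bijection using (⤖⇒↔)
open import Function.Properties.Inverse using (↔-sym)
open import Relation.Binary.PropositionalEquality
open import Relation.Nullary using (Dec; yes; no; ¬?; contradiction)
open import Relation.Nullary.Decidable
  using (from-yes; map′; isYes≗does; dec-true; dec-false; _×-dec_; _⊎-dec_; _→-dec_)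
open import Relation.Unary using (Pred; Decidable)

open ≡-Reasoning

allSubsets? : ∀ {n ℓ} {P : Pred (Subset n) ℓ} → Decidable P → Dec (∀ p → P p)
allSubsets? {n = zero}  P? = map′ (λ P[] → λ { [] → P[] }) (λ ∀P → ∀P []) (P? [])
allSubsets? {n = suc n} P? =
  map′ (λ { (Pin , Pout) (inside ∷ p) → Pin p ; (Pin , Pout) (outside ∷ p) → Pout p })
       (λ ∀P → ∀P ∘ (inside ∷_) , ∀P ∘ (outside ∷_))
       (allSubsets? (P? ∘ (inside ∷_)) ×-dec allSubsets? (P? ∘ (outside ∷_)))

==-refl : ∀ x → (x == x) ≡ true
==-refl x = trans (isYes≗does (x ≟ x)) (dec-true (x ≟ x) refl)

==-≢ : ∀ {x y} → x ≢ y → (x == y) ≡ false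
==-≢ {x} {y} x≢y = trans (isYes≗does (x ≟ y)) (dec-false (x ≟ y) x≢y)

==-injective : ∀ {f : Pt → Pt} → Injective _≡_ _≡_ f → ∀ x y → (f x == f y) ≡ (x == y)
==-injective {f} f-inj x y with x ≟ y | f x ≟ f y
... | yes refl | yes _     = refl
... | yes refl | no fx≢fx  = contradiction refl fx≢fx
... | no x≢y   | yes fx≡fy = contradiction (f-inj fx≡fy) x≢y
... | no _     | no _      = refl

-- Every `from-yes` below is an exhaustive check.  Keeping these opaque matters: a definition
-- that unfolds one of them during conversion checking re-runs the whole search.
opaque
  *-identityˡ : ∀ x → # 0 * x ≡ x
  *-identityˡ = from-yes (all? λ x → # 0 * x ≟ x)

  x*x≡0 : ∀ x → x * x ≡ # 0
  x*x≡0 = from-yes (all? λ x → x * x ≟ # 0)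

  x*y≡0⇒x≡y : ∀ {x y} → x * y ≡ # 0 → x ≡ y
  x*y≡0⇒x≡y {x} {y} = from-yes (all? λ x → all? λ y → (x * y ≟ # 0) →-dec (x ≟ y)) x y

-- With 1, 2, 3 as the standard basis of 𝔽₂³ (so 5 = 1+2, 6 = 1+3, 7 = 2+3, 4 = 1+2+3),
-- basis a b c is the linear map sending 1, 2, 3 to a, b, c.
basis : Pt → Pt → Pt → Pt → Pt
basis a b c 0F = # 0
basis a b c 1F = a
basis a b c 2F = b
basis a b c 3F = c
basis a b c 4F = a * b * c
basis a b c 5F = a * b
basis a b c 6F = a * c
basis a b c 7F = b * c

opaque
  basis-hom : ∀ a b c x y → basis a b c (x * y) ≡ basis a b c x * basis a b c y
  basis-hom = from-yes (all? λ a → all? λ b → all? λ c → all? λ x → all? λ y →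
    basis a b c (x * y) ≟ basis a b c x * basis a b c y)

Independent : Pt → Pt → Pt → Set
Independent a b c = ∀ x → basis a b c x ≡ # 0 → x ≡ # 0

independent? : ∀ a b c → Dec (Independent a b c)
independent? a b c = all? λ x → (basis a b c x ≟ # 0) →-dec (x ≟ # 0)

basis-injective : ∀ {a b c} → Independent a b c → Injective _≡_ _≡_ (basis a b c)
basis-injective {a} {b} {c} ind {x} {y} fx≡fy = x*y≡0⇒x≡y (ind (x * y) (begin
  basis a b c (x * y)            ≡⟨ basis-hom a b c x y ⟩
  basis a b c x * basis a b c y  ≡⟨ cong (_* basis a b c y) fx≡fy ⟩
  basis a b c y * basis a b c y  ≡⟨ x*x≡0 (basis a b c y) ⟩
  # 0                            ∎))

opaque
  basis-surjective : ∀ a b c → Independent a b c → StrictlySurjective _≡_ (basis a b c)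
  basis-surjective = from-yes (all? λ a → all? λ b → all? λ c → independent? a b c →-dec
    all? λ y → any? λ x → basis a b c x ≟ y)

basisCollineation : ∀ a b c → Independent a b c → Collineation
basisCollineation a b c ind = record
  { σ   = ⤖⇒↔ (mk⤖ (basis-injective ind , strictlySurjective⇒surjective (basis-surjective a b c ind)))
  ; hom = basis-hom a b c
  }

⟦_⟧ : Collineation → Pt → Pt
⟦ τ ⟧ = Inverse.to (Collineation.σ τ)

module _ (τ : Collineation) where
  open Collineation τ
  open Inverse σ using (to; from; strictlyInverseˡ; strictlyInverseʳ)

  collineation-0 : to (# 0) ≡ # 0
  collineation-0 = trans (hom (# 0) (# 0)) (x*x≡0 (to (# 0)))

  collineation-injective : Injective _≡_ _≡_ to
  collineation-injective {x} {y} tx≡ty = begin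
    x            ≡⟨ strictlyInverseʳ x ⟨
    from (to x)  ≡⟨ cong from tx≡ty ⟩
    from (to y)  ≡⟨ strictlyInverseʳ y ⟩
    y            ∎

  collineation⁻¹ : Collineation
  collineation⁻¹ = record { σ = ↔-sym σ ; hom = from-hom }
    where
    from-hom : ∀ i j → from (i * j) ≡ from i * from j
    from-hom i j = begin
      from (i * j)                      ≡⟨ cong from (cong₂ _*_ (strictlyInverseˡ i) (strictlyInverseˡ j)) ⟨
      from (to (from i) * to (from j))  ≡⟨ cong from (hom (from i) (from j)) ⟨
      from (to (from i * from j))       ≡⟨ strictlyInverseʳ _ ⟩
      from i * from j                   ∎

  ==0-collineation : ∀ x → (to x == # 0) ≡ (x == # 0)
  ==0-collineation x = begin
    to x == # 0       ≡⟨ cong (to x ==_) collineation-0 ⟨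
    to x == to (# 0)  ≡⟨ ==-injective collineation-injective x (# 0) ⟩
    x == # 0          ∎

infix 4 _≗₂_

_≗₂_ : PairSet → PairSet → Set
T ≗₂ T′ = ∀ i j → T i j ≡ T′ i j

pullback : (Pt → Pt) → PairSet → PairSet
pullback f T i j = T (f i) (f j)

collinear-by-pullback : ∀ {T A} (τ : Collineation) → pullback ⟦ τ ⟧ T ≗₂ A → Collinear T A
collinear-by-pullback {T} {A} τ τ*T≗A = collineation⁻¹ τ , λ i j → begin
  A (from i) (from j)            ≡⟨ τ*T≗A (from i) (from j) ⟨
  T (to (from i)) (to (from j))  ≡⟨ cong₂ T (strictlyInverseˡ i) (strictlyInverseˡ j) ⟩
  T i j                          ∎
  where open Inverse (Collineation.σ τ) using (to; from; strictlyInverseˡ)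

pullback-S'J : ∀ S J (τ : Collineation) →
  pullback ⟦ τ ⟧ (S'J S J) ≗₂ S'J (pullback ⟦ τ ⟧ S) (J ∘ ⟦ τ ⟧)
pullback-S'J S J τ i j rewrite ==0-collineation τ i | ==0-collineation τ j = refl

S'J-cong : ∀ {S S′ J J′} → S ≗₂ S′ → J ≗ J′ → S'J S J ≗₂ S'J S′ J′
S'J-cong S≗S′ J≗J′ i j rewrite S≗S′ i j | J≗J′ i | J≗J′ j = refl

-- card T inspects only the 64 values T i j, so it agrees definitionally with the card of the
-- tabulated copy of T; this replaces function extensionality.
card-cong : ∀ {T T′} → T ≗₂ T′ → card T ≡ card T′
card-cong T≗T′ = cong (card ∘ fromTable) (tabulate-cong λ i → tabulate-cong (T≗T′ i))
  where
  fromTable : Vec (Vec Bool 8) 8 → PairSet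
  fromTable t i j = lookup (lookup t i) j

singleton : Pt → Pt → PairSet
singleton a b = fromPairs ((a , b) ∷ [])

opaque
  card-singleton : ∀ {a b} → a ≢ b → card (singleton a b) ≡ 1
  card-singleton {a} {b} =
    from-yes (all? λ a → all? λ b → ¬? (a ≟ b) →-dec (card (singleton a b) ℕ.≟ 1)) a b

singleton-pullback : ∀ {f : Pt → Pt} → Injective _≡_ _≡_ f → ∀ a b →
  pullback f (singleton (f a) (f b)) ≗₂ singleton a b
singleton-pullback f-inj a b i j
  rewrite ==-injective f-inj a i | ==-injective f-inj b j
        | ==-injective f-inj a j | ==-injective f-inj b i = refl

singleton-true⇒ : ∀ {a b i j} → singleton a b i j ≡ true → (a ≡ i × b ≡ j) ⊎ (a ≡ j × b ≡ i)
singleton-true⇒ {a} {b} {i} {j} h with a ≟ i | b ≟ j | a ≟ j | b ≟ i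
... | yes a≡i | yes b≡j | _       | _       = inj₁ (a≡i , b≡j)
... | _       | _       | yes a≡j | yes b≡i = inj₂ (a≡j , b≡i)
... | no _    | _       | no _    | _       = contradiction h λ ()
... | no _    | _       | yes _   | no _    = contradiction h λ ()
... | yes _   | no _    | no _    | _       = contradiction h λ ()
... | yes _   | no _    | yes _   | no _    = contradiction h λ ()

singleton-unique : ∀ {R a b} → Symmetric R → (a , b) ∈P R →
  (∀ {i j} → (i , j) ∈P R → (a ≡ i × b ≡ j) ⊎ (a ≡ j × b ≡ i)) → R ≗₂ singleton a b
singleton-unique {R} {a} {b} R-sym ab∈R edge i j =
  Bool.⇔→≡ (mk⇔ (∈singleton ∘ edge) (∈R ∘ singleton-true⇒))
  where
  ∈singleton : (a ≡ i × b ≡ j) ⊎ (a ≡ j × b ≡ i) → singleton a b i j ≡ true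
  ∈singleton (inj₁ (refl , refl)) rewrite ==-refl a | ==-refl b = refl
  ∈singleton (inj₂ (refl , refl)) rewrite ==-refl a | ==-refl b = Bool.∨-zeroʳ _
  ∈R : (a ≡ i × b ≡ j) ⊎ (a ≡ j × b ≡ i) → (i , j) ∈P R
  ∈R (inj₁ (refl , refl)) = ab∈R
  ∈R (inj₂ (refl , refl)) = trans (R-sym b a) ab∈R

InX : Pt → Pt → Set
InX c d = c ≢ # 0 × d ≢ # 0 × c ≢ d

InX? : ∀ c d → Dec (InX c d)
InX? c d = ¬? (c ≟ # 0) ×-dec ¬? (d ≟ # 0) ×-dec ¬? (c ≟ d)

InX-pullback : ∀ {f : Pt → Pt} → f (# 0) ≡ # 0 → ∀ {i j} → InX (f i) (f j) → InX i j
InX-pullback f0≡0 (fi≢0 , fj≢0 , fi≢fj) =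
  (λ { refl → fi≢0 f0≡0 }) , (λ { refl → fj≢0 f0≡0 }) , (λ { refl → fi≢fj refl })

Monochromatic : (Pt → Bool) → Pt → Pt → Set
Monochromatic J c d = J c ≡ J d × J c ≡ J (c * d)

monochromatic? : ∀ J c d → Dec (Monochromatic J c d)
monochromatic? J c d = (J c Bool.≟ J d) ×-dec (J c Bool.≟ J (c * d))

monochromatic-pullback : ∀ {J J′ : Pt → Bool} {f : Pt → Pt} → (∀ x y → f (x * y) ≡ f x * f y) →
  J ∘ f ≗ J′ → ∀ {i j} → Monochromatic J (f i) (f j) → Monochromatic J′ i j
monochromatic-pullback {J} {J′} {f} f-hom J∘f≗J′ {i} {j} (Jfi≡Jfj , Jfi≡Jfifj) =
    (begin
      J′ i     ≡⟨ J∘f≗J′ i ⟨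
      J (f i)  ≡⟨ Jfi≡Jfj ⟩
      J (f j)  ≡⟨ J∘f≗J′ j ⟩
      J′ j     ∎)
  , (begin
      J′ i           ≡⟨ J∘f≗J′ i ⟨
      J (f i)        ≡⟨ Jfi≡Jfifj ⟩
      J (f i * f j)  ≡⟨ cong J (f-hom i j) ⟨
      J (f (i * j))  ≡⟨ J∘f≗J′ (i * j) ⟩
      J′ (i * j)     ∎)

product-edge∉ : ∀ {S} → GenNice S → (∀ i → S i i ≡ false) →
  ∀ {u v} → (u , v) ∈P S → (u * v , v) ∈P S → ⊥
product-edge∉ S-nice S-irrefl {u} {v} uv∈S [u*v]v∈S =
  Bool.not-¬ (S-irrefl v) (proj₁ (proj₂ (S-nice u v v uv∈S [u*v]v∈S)))

module _ {S : PairSet} (S-sym : Symmetric S) (S⊆X : SubsetOfX S) where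

  edge-InX : ∀ {c d} → (c , d) ∈P S → InX c d
  edge-InX {c} {d} cd∈S = c≢0 , d≢0 , c≢d
    where
    c≢0 : c ≢ # 0
    c≢0 refl = Bool.not-¬ (proj₂ S⊆X d) cd∈S
    d≢0 : d ≢ # 0
    d≢0 refl = Bool.not-¬ (trans (S-sym c (# 0)) (proj₂ S⊆X c)) cd∈S
    c≢d : c ≢ d
    c≢d refl = Bool.not-¬ (proj₁ S⊆X c) cd∈S

  edge-product≢0 : ∀ {c d} → (c , d) ∈P S → c * d ≢ # 0
  edge-product≢0 cd∈S = proj₂ (proj₂ (edge-InX cd∈S)) ∘ x*y≡0⇒x≡y

  module _ {J : Pt → Bool} (S′-nice : GenNice (S'J S J)) where

    private
      S′ : PairSet
      S′ = S'J S J

      ∈S⇒∈S′ : ∀ {c d} → (c , d) ∈P S → (c , d) ∈P S′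
      ∈S⇒∈S′ cd∈S rewrite cd∈S = refl

      S′-0ˡ : ∀ {x} → x ≢ # 0 → S′ (# 0) x ≡ J x
      S′-0ˡ {x} x≢0 rewrite proj₂ S⊆X x | ==-≢ x≢0 = Bool.∨-identityʳ (J x)

      S′-0ʳ : ∀ {x} → x ≢ # 0 → S′ x (# 0) ≡ J x
      S′-0ʳ {x} x≢0 rewrite S-sym x (# 0) | proj₂ S⊆X x | ==-≢ x≢0 = refl

    J-closed : ∀ {c d} → (c , d) ∈P S → J c ≡ true → J d ≡ true × J (c * d) ≡ true
    J-closed {c} {d} cd∈S Jc =
      let c≢0 , d≢0 , _ = edge-InX cd∈S
          0c∈S′ = trans (S′-0ˡ c≢0) Jc
          [0*c]d∈S′ = subst (λ x → (x , d) ∈P S′) (sym (*-identityˡ c)) (∈S⇒∈S′ cd∈S)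
          _ , _ , d0∈S′ , 0cd∈S′ , _ = S′-nice (# 0) c d 0c∈S′ [0*c]d∈S′
      in trans (sym (S′-0ʳ d≢0)) d0∈S′ , trans (sym (S′-0ˡ (edge-product≢0 cd∈S))) 0cd∈S′

    J-reflect : ∀ {c d} → (c , d) ∈P S → J (c * d) ≡ true → J c ≡ true
    J-reflect {c} {d} cd∈S Jcd =
      let [c*d]0∈S′ = trans (S′-0ʳ (edge-product≢0 cd∈S)) Jcd
          _ , _ , 0c∈S′ , _ = S′-nice c d (# 0) (∈S⇒∈S′ cd∈S) [c*d]0∈S′
      in trans (sym (S′-0ˡ (proj₁ (edge-InX cd∈S)))) 0c∈S′

    monochromatic : ∀ {c d} → (c , d) ∈P S → Monochromatic J c d
    monochromatic {c} {d} cd∈S =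
        Bool.⇔→≡ (mk⇔ (proj₁ ∘ J-closed cd∈S) (proj₁ ∘ J-closed (trans (S-sym d c) cd∈S)))
      , Bool.⇔→≡ (mk⇔ (proj₂ ∘ J-closed cd∈S) (J-reflect cd∈S))

J₁ J₂ : Subset 8
J₁ = ⁅ # 3 ⁆ ∪ ⁅ # 4 ⁆ ∪ ⁅ # 6 ⁆ ∪ ⁅ # 7 ⁆
J₂ = ⁅ # 1 ⁆ ∪ ⁅ # 2 ⁆ ∪ ⁅ # 5 ⁆ ∪ ⁅ # 3 ⁆

data NormalForm : Subset 8 → PairSet → Set where
  lineComplement : NormalForm J₁ A₁
  lineAndPoint   : NormalForm J₂ A₂

infix 4 _≗?_ _≗₂?_

_≗?_ : (J J′ : Pt → Bool) → Dec (J ≗ J′)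
J ≗? J′ = all? λ x → J x Bool.≟ J′ x

_≗₂?_ : (T T′ : PairSet) → Dec (T ≗₂ T′)
T ≗₂? T′ = all? λ i → all? λ j → T i j Bool.≟ T′ i j

OnLine₁₂₅ : Pt → Set
OnLine₁₂₅ x = x ≡ 1F ⊎ x ≡ 2F ⊎ x ≡ 5F

MonochromaticOnLine₁₂₅ : (Pt → Bool) → Set
MonochromaticOnLine₁₂₅ J = ∀ i j → InX i j → Monochromatic J i j → OnLine₁₂₅ i × OnLine₁₂₅ j

monochromaticOnLine₁₂₅? : ∀ J → Dec (MonochromaticOnLine₁₂₅ J)
monochromaticOnLine₁₂₅? J = all? λ i → all? λ j →
  InX? i j →-dec (monochromatic? J i j →-dec (onLine? i ×-dec onLine? j))
  where
  onLine? : ∀ x → Dec (OnLine₁₂₅ x)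
  onLine? x = x ≟ 1F ⊎-dec x ≟ 2F ⊎-dec x ≟ 5F

opaque
  normalForm-S'J : ∀ {J A} → NormalForm J A → S'J (singleton 1F 2F) (lookup J) ≗₂ A
  normalForm-S'J lineComplement = from-yes (S'J (singleton 1F 2F) (lookup J₁) ≗₂? A₁)
  normalForm-S'J lineAndPoint   = from-yes (S'J (singleton 1F 2F) (lookup J₂) ≗₂? A₂)

  normalForm-onLine : ∀ {J A} → NormalForm J A → MonochromaticOnLine₁₂₅ (lookup J)
  normalForm-onLine lineComplement = from-yes (monochromaticOnLine₁₂₅? (lookup J₁))
  normalForm-onLine lineAndPoint   = from-yes (monochromaticOnLine₁₂₅? (lookup J₂))

  normalFrame : ∀ J → # 0 ∉ J → ∣ J ∣ ≡ 4 → ∀ c d → InX c d → Monochromatic (lookup J) c d →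
    ∃ λ e → Independent c d e
          × (lookup J ∘ basis c d e ≗ lookup J₁ ⊎ lookup J ∘ basis c d e ≗ lookup J₂)
  normalFrame = from-yes (allSubsets? λ J →
    ¬? (# 0 ∈? J) →-dec ((∣ J ∣ ℕ.≟ 4) →-dec (all? λ c → all? λ d →
    InX? c d →-dec (monochromatic? (lookup J) c d →-dec (any? λ e →
    independent? c d e ×-dec
      ((lookup J ∘ basis c d e ≗? lookup J₁) ⊎-dec (lookup J ∘ basis c d e ≗? lookup J₂)))))))

module _ {S : PairSet} (S-sym : Symmetric S) (S⊆X : SubsetOfX S) (S-nice : GenNice S)
         {J : Pt → Bool} (S′-nice : GenNice (S'J S J))
         {c d e : Pt} (ind : Independent c d e) (cd∈S : (c , d) ∈P S)
         {J₀ : Subset 8} {A : PairSet} (nf : NormalForm J₀ A) (frame : J ∘ basis c d e ≗ lookup J₀) where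

  private
    τ : Collineation
    τ = basisCollineation c d e ind

    f : Pt → Pt
    f = basis c d e

    R : PairSet
    R = pullback f S

    R-sym : Symmetric R
    R-sym i j = S-sym (f i) (f j)

    R-InX : ∀ {i j} → (i , j) ∈P R → InX i j
    R-InX ij∈R = InX-pullback refl (edge-InX S-sym S⊆X ij∈R)

    R-product-edge∉ : ∀ u v → (u , v) ∈P R → (u * v , v) ∈P R → ⊥
    R-product-edge∉ u v uv∈R [u*v]v∈R =
      product-edge∉ S-nice (proj₁ S⊆X) uv∈R (subst (λ x → (x , f v) ∈P S) (basis-hom c d e u v) [u*v]v∈R)

    -- {1,5} and {2,5} are excluded because 2 * 1 = 1 * 2 = 5 and {1,2} ∈ R.
    line-edge⇒12 : ∀ {i j} → (i , j) ∈P R → i ≢ j → OnLine₁₂₅ i × OnLine₁₂₅ j →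
      (1F ≡ i × 2F ≡ j) ⊎ (1F ≡ j × 2F ≡ i)
    line-edge⇒12 _    _   (inj₁ refl        , inj₂ (inj₁ refl)) = inj₁ (refl , refl)
    line-edge⇒12 _    _   (inj₂ (inj₁ refl) , inj₁ refl)        = inj₂ (refl , refl)
    line-edge⇒12 15∈R _   (inj₁ refl        , inj₂ (inj₂ refl)) =
      ⊥-elim (R-product-edge∉ 2F 1F (trans (R-sym 2F 1F) cd∈S) (trans (R-sym 5F 1F) 15∈R))
    line-edge⇒12 51∈R _   (inj₂ (inj₂ refl) , inj₁ refl)        =
      ⊥-elim (R-product-edge∉ 2F 1F (trans (R-sym 2F 1F) cd∈S) 51∈R)
    line-edge⇒12 25∈R _   (inj₂ (inj₁ refl) , inj₂ (inj₂ refl)) =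
      ⊥-elim (R-product-edge∉ 1F 2F cd∈S (trans (R-sym 5F 2F) 25∈R))
    line-edge⇒12 52∈R _   (inj₂ (inj₂ refl) , inj₂ (inj₁ refl)) =
      ⊥-elim (R-product-edge∉ 1F 2F cd∈S 52∈R)
    line-edge⇒12 _    i≢i (inj₁ refl        , inj₁ refl)        = contradiction refl i≢i
    line-edge⇒12 _    i≢i (inj₂ (inj₁ refl) , inj₂ (inj₁ refl)) = contradiction refl i≢i
    line-edge⇒12 _    i≢i (inj₂ (inj₂ refl) , inj₂ (inj₂ refl)) = contradiction refl i≢i

    R-edge⇒12 : ∀ {i j} → (i , j) ∈P R → (1F ≡ i × 2F ≡ j) ⊎ (1F ≡ j × 2F ≡ i)
    R-edge⇒12 {i} {j} ij∈R =
      line-edge⇒12 ij∈R (proj₂ (proj₂ ij∈X)) (normalForm-onLine nf i j ij∈X ij-mono)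
      where
      ij∈X : InX i j
      ij∈X = R-InX {i} {j} ij∈R
      ij-mono : Monochromatic (lookup J₀) i j
      ij-mono = monochromatic-pullback {J = J} {f = f} (basis-hom c d e) frame
                  (monochromatic S-sym S⊆X S′-nice ij∈R)

    R≗singleton : R ≗₂ singleton 1F 2F
    R≗singleton = singleton-unique R-sym cd∈S R-edge⇒12

  S≗singleton : S ≗₂ singleton c d
  S≗singleton x y = begin
    S x y                                    ≡⟨ cong₂ S (strictlyInverseˡ x) (strictlyInverseˡ y) ⟨
    R (from x) (from y)                      ≡⟨ R≗singleton (from x) (from y) ⟩
    singleton 1F 2F (from x) (from y)        ≡⟨ singleton-pullback (collineation-injective τ) 1F 2F (from x) (from y) ⟨
    singleton c d (f (from x)) (f (from y))  ≡⟨ cong₂ (singleton c d) (strictlyInverseˡ x) (strictlyInverseˡ y) ⟩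
    singleton c d x y                        ∎
    where open Inverse (Collineation.σ τ) using (from; strictlyInverseˡ)

  classification : card S ≡ 1 × Collinear (S'J S J) A
  classification =
      trans (card-cong S≗singleton) (card-singleton (proj₂ (proj₂ (edge-InX S-sym S⊆X cd∈S))))
    , collinear-by-pullback τ λ i j → begin
        S'J S J (f i) (f j)                    ≡⟨ pullback-S'J S J τ i j ⟩
        S'J R (J ∘ f) i j                      ≡⟨ S'J-cong R≗singleton frame i j ⟩
        S'J (singleton 1F 2F) (lookup J₀) i j  ≡⟨ normalForm-S'J nf i j ⟩
        A i j                                  ∎

proposition6p10 : (S : PairSet) → Symmetric S → SubsetOfX S → NonEmpty S → GenNice S
    → (J : Subset 8) → # 0 ∉ J → ∣ J ∣ ≡ 4
    → GenNice (S'J S (lookup J))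
    → card S ≡ 1 × (Collinear (S'J S (lookup J)) A₁ ⊎ Collinear (S'J S (lookup J)) A₂)
proposition6p10 S S-sym S⊆X (c , d , cd∈S) S-nice J 0∉J ∣J∣≡4 S′-nice
  with normalFrame J 0∉J ∣J∣≡4 c d (edge-InX S-sym S⊆X cd∈S) (monochromatic S-sym S⊆X S′-nice cd∈S)
... | _ , ind , inj₁ frame = map₂ inj₁ (classification S-sym S⊆X S-nice S′-nice ind cd∈S lineComplement frame)
... | _ , ind , inj₂ frame = map₂ inj₂ (classification S-sym S⊆X S-nice S′-nice ind cd∈S lineAndPoint frame)
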